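{- Let $n > 3$ and let $T$ be a tree on $n$ vertices whose weighted Szeged index is minimum among all trees on $n$ vertices. Then no vertex of $T$ of degree at least $6$ is adjacent to two leaves.
   Context: For a connected simple graph $G$ and an edge $e = uv \in E(G)$, let $n_u(e)$ denote the number of vertices $x \in V(G)$ with $d(x,u) < d(x,v)$, where $d$ is the shortest-path distance in $G$ (and similarly $n_v(e)$). The weighted Szeged index of $G$ is $$wSz(G) = \sum_{e = uv \in E(G)} \big(\deg(u) + \deg(v)\big)\, n_u(e)\, n_v(e),$$ where $\deg(u)$ is the degree of $u$. A leaf is a vertex of degree $1$. -}

module Defs where

open import Data.Nat using (ℕ; zero; suc; _+_; _*_; _∸_; _<ᵇ_; _≡ᵇ_)
open import Data.Bool using (Bool; true; false; _∧_; _∨_; if_then_else_)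
open import Data.Fin using (Fin; toℕ)
open import Data.Fin.Properties using (_≟_)
open import Data.List using (List; map; filter; length; allFin)
open import Data.Nat.ListAction using (sum)
open import Data.Bool.ListAction using (any)
open import Relation.Nullary.Decidable using (⌊_⌋)
open import Relation.Binary.PropositionalEquality using (_≡_)
open import Data.Product using (_×_)

record Graph (n : ℕ) : Set where
  field
    adj    : Fin n → Fin n → Bool
    sym    : ∀ u v → adj u v ≡ adj v u
    irrefl : ∀ u → adj u u ≡ false
open Graph public

vertices : (n : ℕ) → List (Fin n)
vertices n = allFin n

count : {n : ℕ} → (Fin n → Bool) → ℕ
count {n} p = length (filter (λ x → p x Data.Bool.≟ true) (vertices n))

deg : {n : ℕ} → Graph n → Fin n → ℕ
deg G u = count (adj G u)

reach : {n : ℕ} → Graph n → ℕ → Fin n → Fin n → Bool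
reach G zero    x y = ⌊ x ≟ y ⌋
reach {n} G (suc k) x y =
  reach G k x y ∨ any (λ z → reach G k x z ∧ adj G z y) (vertices n)

-- least k ≤ bound with reach G k x y, searching upward from `start`
-- (returns start + fuel if none found)
searchDist : {n : ℕ} → Graph n → Fin n → Fin n → (start fuel : ℕ) → ℕ
searchDist G x y start zero = start
searchDist G x y start (suc fuel) =
  if reach G start x y then start else searchDist G x y (suc start) fuel

-- shortest-path distance (correct for connected graphs, where every
-- distance is at most n)
dist : {n : ℕ} → Graph n → Fin n → Fin n → ℕ
dist {n} G x y = searchDist G x y 0 n

Connected : {n : ℕ} → Graph n → Set
Connected {n} G = ∀ x y → reach G n x y ≡ true

edgeCount : {n : ℕ} → Graph n → ℕ
edgeCount G = sum (map (λ u → count (λ v → (toℕ u <ᵇ toℕ v) ∧ adj G u v)) (vertices _))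

IsTree : {n : ℕ} → Graph n → Set
IsTree {n} G = Connected G × edgeCount G ≡ n ∸ 1

nClose : {n : ℕ} → Graph n → Fin n → Fin n → ℕ
nClose G u v = count (λ x → dist G x u <ᵇ dist G x v)

wSz : {n : ℕ} → Graph n → ℕ
wSz {n} G = sum (map (λ u → sum (map (λ v →
    if (toℕ u <ᵇ toℕ v) ∧ adj G u v
    then (deg G u + deg G v) * nClose G u v * nClose G v u
    else 0) (vertices n))) (vertices n))

IsLeaf : {n : ℕ} → Graph n → Fin n → Set
IsLeaf G v = deg G v ≡ 1

-- Let a and b be leaves at v with d = deg v, and let H be T with b re-hung on a. H is again a
-- tree, and distances between vertices other than b are the same in H and T, so only edges at
-- v, a and b change their terms in wSz. Every other edge vw loses n_v n_w because deg v drops by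
-- one; as n_v ≥ 3 (v, a, b) and every vertex outside {v, a, b} lies behind one of these w, the
-- losses total at least 3 (n - 3). The edges va, vb of T contribute 2 (d + 1) (n - 1), the edges
-- va, ab of H at most 2 (d + 1) (n - 2) + 3 (n - 1). Hence wSz T - wSz H ≥ 2 d - 4 > 0 once d ≥ 3.

module Submission where

open import Defs hiding (sym)
open import Data.Bool using (Bool; true; false; _∧_; _∨_; not; if_then_else_; T)
import Data.Bool as Bool
open import Data.Bool.Properties using (T-≡; T-∧; T-∨; ∧-identityʳ; ∧-zeroʳ; ∨-zeroʳ; not-¬; ¬-not)
open import Data.Empty using (⊥-elim)
open import Data.Fin using (Fin; zero; suc; toℕ)
open import Data.Fin.Properties using (_≟_; any?; toℕ-injective)
open import Data.List using (filter; length; map; tabulate)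
open import Data.List.Membership.Propositional using (lose)
open import Data.List.Membership.Propositional.Properties using (∈-allFin)
open import Data.List.Relation.Unary.Any using (satisfied)
open import Data.List.Relation.Unary.Any.Properties using (any⁺; any⁻)
open import Data.Nat hiding (_≟_)
open import Data.Nat.ListAction using () renaming (sum to sumˡ)
open import Data.Nat.Properties hiding (_≟_)
open import Data.Nat.Tactic.RingSolver using (solve-∀)
open import Algebra.Properties.Semiring.Sum +-*-semiring
  using (sum; ∑-distrib-+; ∑-comm; sum-cong-≗; *-distribˡ-sum)
open import Algebra.Properties.CommutativeSemigroup +-commutativeSemigroup using (x∙yz≈y∙xz)
open import Data.Product using (∃; _×_; _,_; proj₁; proj₂)
open import Data.Sum using (_⊎_; inj₁; inj₂)
open import Function using (_∘_; Equivalence)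
open import Relation.Binary.Definitions using (tri<; tri≈; tri>)
open import Relation.Nullary using (¬_; yes; no)
open import Relation.Nullary.Decidable using (⌊_⌋; toSum)
open import Relation.Binary.PropositionalEquality

open Equivalence using (to; from)

_==_ : ∀ {n} → Fin n → Fin n → Bool
i == j = ⌊ i ≟ j ⌋

==-refl : ∀ {n} (i : Fin n) → (i == i) ≡ true
==-refl i with i ≟ i
... | yes _ = refl
... | no i≢i = ⊥-elim (i≢i refl)

==-≢ : ∀ {n} {i j : Fin n} → i ≢ j → (i == j) ≡ false
==-≢ {i = i} {j} i≢j with i ≟ j
... | yes i≡j = ⊥-elim (i≢j i≡j)
... | no _ = refl

==⇒≡ : ∀ {n} {i j : Fin n} → (i == j) ≡ true → i ≡ j
==⇒≡ {i = i} {j} e with i ≟ j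
... | yes i≡j = i≡j

⟦_⟧ : Bool → ℕ
⟦ true ⟧ = 1
⟦ false ⟧ = 0

sum-mono-≤ : ∀ {n} {f g : Fin n → ℕ} → (∀ i → f i ≤ g i) → sum f ≤ sum g
sum-mono-≤ {zero} f≤g = z≤n
sum-mono-≤ {suc n} f≤g = +-mono-≤ (f≤g zero) (sum-mono-≤ (f≤g ∘ suc))

sum-zero : ∀ {n} {f : Fin n → ℕ} → (∀ i → f i ≡ 0) → sum f ≡ 0
sum-zero {zero} f≡0 = refl
sum-zero {suc n} f≡0 rewrite f≡0 zero = sum-zero (f≡0 ∘ suc)

sum-one : ∀ n → sum {n} (λ _ → 1) ≡ n
sum-one zero = refl
sum-one (suc n) = cong suc (sum-one n)

sum-removePoint : ∀ {n} (f : Fin n → ℕ) (p : Fin n) →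
  sum f ≡ f p + sum (λ i → if i == p then 0 else f i)
sum-removePoint f zero = refl
sum-removePoint f (suc p) = begin
  f zero + sum (f ∘ suc)
    ≡⟨ cong (f zero +_) (sum-removePoint (f ∘ suc) p) ⟩
  f zero + (f (suc p) + sum (λ i → if i == p then 0 else f (suc i)))
    ≡⟨ x∙yz≈y∙xz (f zero) (f (suc p)) _ ⟩
  f (suc p) + (f zero + sum (λ i → if i == p then 0 else f (suc i)))
    ≡⟨ cong (λ s → f (suc p) + (f zero + s))
            (sum-cong-≗ λ i → cong (λ b → if b then 0 else f (suc i)) (sym (==-suc i p))) ⟩
  f (suc p) + sum (λ i → if i == suc p then 0 else f i) ∎
  where
  open ≡-Reasoning
  ==-suc : ∀ {n} (i j : Fin n) → (suc i == suc j) ≡ (i == j)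
  ==-suc i j with i ≟ j
  ... | yes _ = refl
  ... | no _ = refl

sum-point : ∀ {n} (f : Fin n → ℕ) (p : Fin n) → (∀ i → i ≢ p → f i ≡ 0) → sum f ≡ f p
sum-point f p off-p = trans (sum-removePoint f p) (trans (cong (f p +_) (sum-zero rest≡0)) (+-identityʳ (f p)))
  where
  rest≡0 : ∀ i → (if i == p then 0 else f i) ≡ 0
  rest≡0 i with i ≟ p
  ... | yes _ = refl
  ... | no i≢p = off-p i i≢p

≤-sum : ∀ {n} (f : Fin n → ℕ) (p : Fin n) → f p ≤ sum f
≤-sum f p rewrite sum-removePoint f p = m≤m+n (f p) _

#_ : ∀ {n} → (Fin n → Bool) → ℕ
# p = sum (λ i → ⟦ p i ⟧)

count≡# : ∀ {n} (p : Fin n → Bool) → count p ≡ # p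
count≡# {n} p = length-filter-tabulate {n = n} (λ i → i)
  where
  length-filter-tabulate : ∀ {A : Set} {n} (f : Fin n → A) {p : A → Bool} →
    length (filter (λ x → p x Bool.≟ true) (tabulate f)) ≡ sum (λ i → ⟦ p (f i) ⟧)
  length-filter-tabulate {n = zero} f = refl
  length-filter-tabulate {n = suc n} f {p} with p (f zero)
  ... | true = cong suc (length-filter-tabulate (f ∘ suc))
  ... | false = length-filter-tabulate (f ∘ suc)

#-cong : ∀ {n} {p q : Fin n → Bool} → (∀ i → p i ≡ q i) → # p ≡ # q
#-cong p≗q = sum-cong-≗ (cong ⟦_⟧ ∘ p≗q)

⟦⟧-mono : ∀ {b c} → (b ≡ true → c ≡ true) → ⟦ b ⟧ ≤ ⟦ c ⟧
⟦⟧-mono {false} b⇒c = z≤n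
⟦⟧-mono {true} b⇒c rewrite b⇒c refl = ≤-refl

#-mono : ∀ {n} {p q : Fin n → Bool} → (∀ i → p i ≡ true → q i ≡ true) → # p ≤ # q
#-mono p⊆q = sum-mono-≤ (λ i → ⟦⟧-mono (p⊆q i))

#-none : ∀ {n} {p : Fin n → Bool} → (∀ i → p i ≡ false) → # p ≡ 0
#-none p≡false = sum-zero (cong ⟦_⟧ ∘ p≡false)

#-complement : ∀ {n} (p : Fin n → Bool) → # p + # (not ∘ p) ≡ n
#-complement {n} p = begin
  # p + # (not ∘ p)                    ≡⟨ ∑-distrib-+ (λ i → ⟦ p i ⟧) (λ i → ⟦ not (p i) ⟧) ⟨
  sum (λ i → ⟦ p i ⟧ + ⟦ not (p i) ⟧) ≡⟨ sum-cong-≗ (λ i → one (p i)) ⟩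
  sum {n} (λ _ → 1)                    ≡⟨ sum-one n ⟩
  n                                    ∎
  where
  open ≡-Reasoning
  one : ∀ b → ⟦ b ⟧ + ⟦ not b ⟧ ≡ 1
  one true = refl
  one false = refl

#-∨ : ∀ {n} (p q : Fin n → Bool) → # (λ i → p i ∨ q i) ≤ # p + # q
#-∨ p q = ≤-trans (sum-mono-≤ (λ i → ⟦∨⟧ (p i) (q i)))
                  (≤-reflexive (∑-distrib-+ (λ i → ⟦ p i ⟧) (λ i → ⟦ q i ⟧)))
  where
  ⟦∨⟧ : ∀ b c → ⟦ b ∨ c ⟧ ≤ ⟦ b ⟧ + ⟦ c ⟧
  ⟦∨⟧ true c = s≤s z≤n
  ⟦∨⟧ false c = ≤-refl

infixl 6 _∖_

_∖_ : ∀ {n} → (Fin n → Bool) → Fin n → (Fin n → Bool)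
(p ∖ j) i = p i ∧ not (i == j)

∖-keeps : ∀ {n} (p : Fin n → Bool) {i j} → i ≢ j → (p ∖ j) i ≡ p i
∖-keeps p i≢j rewrite ==-≢ i≢j = ∧-identityʳ _

∖⁺ : ∀ {n} (p : Fin n → Bool) {i j} → p i ≡ true → i ≢ j → (p ∖ j) i ≡ true
∖⁺ p pi i≢j = trans (∖-keeps p i≢j) pi

∖⁻ : ∀ {n} (p : Fin n → Bool) {i j} → (p ∖ j) i ≡ true → p i ≡ true × i ≢ j
∖⁻ p {i} {j} p∖j with p i | i ≟ j
... | true | no i≢j = refl , i≢j

#-∖ : ∀ {n} (p : Fin n → Bool) {j} → p j ≡ true → # p ≡ suc (# (p ∖ j))
#-∖ p {j} pj = trans (sum-removePoint (λ i → ⟦ p i ⟧) j) (cong₂ _+_ (cong ⟦_⟧ pj) (sum-cong-≗ removed))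
  where
  removed : ∀ i → (if i == j then 0 else ⟦ p i ⟧) ≡ ⟦ (p ∖ j) i ⟧
  removed i with i == j | p i
  ... | true | true = refl
  ... | true | false = refl
  ... | false | true = refl
  ... | false | false = refl

#-pos : ∀ {n} (p : Fin n → Bool) {j} → p j ≡ true → 1 ≤ # p
#-pos p pj rewrite #-∖ p pj = s≤s z≤n

#-two : ∀ {n} (p : Fin n → Bool) {i j} → i ≢ j → p i ≡ true → p j ≡ true → 2 ≤ # p
#-two p i≢j pi pj rewrite #-∖ p pi = s≤s (#-pos (p ∖ _) (trans (∖-keeps p (i≢j ∘ sym)) pj))

#-three : ∀ {n} (p : Fin n → Bool) {i j l} → i ≢ j → i ≢ l → j ≢ l →
  p i ≡ true → p j ≡ true → p l ≡ true → 3 ≤ # p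
#-three p i≢j i≢l j≢l pi pj pl rewrite #-∖ p pi =
  s≤s (#-two (p ∖ _) j≢l (trans (∖-keeps p (i≢j ∘ sym)) pj) (trans (∖-keeps p (i≢l ∘ sym)) pl))

#-singleton : ∀ {n} (j : Fin n) → # (_== j) ≡ 1
#-singleton j = trans (#-∖ (_== j) (==-refl j)) (cong suc (#-none only-j))
  where
  only-j : ∀ i → ((_== j) ∖ j) i ≡ false
  only-j i with i == j
  ... | true = refl
  ... | false = refl

#-full : ∀ {n} (p : Fin n → Bool) → n ≤ # p → ∀ i → p i ≡ true
#-full {n} p n≤#p i with p i in pi
... | true = refl
... | false = ⊥-elim (<⇒≱ #p<n n≤#p)
  where
  #p<n : # p < n
  #p<n = subst (# p <_) (#-complement p)
    (subst (_≤ # p + # (not ∘ p)) (+-comm (# p) 1) (+-monoʳ-≤ (# p) (#-pos (not ∘ p) (cong not pi))))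

#-strict : ∀ {n} {p q : Fin n → Bool} → (∀ i → p i ≡ true → q i ≡ true) →
  ∀ {j} → p j ≡ false → q j ≡ true → # p < # q
#-strict {p = p} {q} p⊆q {j} pj qj rewrite #-∖ q qj = s≤s (#-mono p⊆q∖j)
  where
  p⊆q∖j : ∀ i → p i ≡ true → (q ∖ j) i ≡ true
  p⊆q∖j i pi with i ≟ j
  ... | yes refl = ⊥-elim (not-¬ pi pj)
  ... | no _ = trans (∧-identityʳ (q i)) (p⊆q i pi)

#-union : ∀ {m n} (r : Fin n → Bool) (q : Fin m → Fin n → Bool) →
  (∀ z → r z ≡ true → ∃ λ w → q w z ≡ true) → # r ≤ sum (λ w → # (q w))
#-union r q covered = ≤-trans (sum-mono-≤ pointwise) (≤-reflexive (∑-comm (λ z w → ⟦ q w z ⟧)))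
  where
  pointwise : ∀ z → ⟦ r z ⟧ ≤ sum (λ w → ⟦ q w z ⟧)
  pointwise z with r z in rz
  ... | false = z≤n
  ... | true with covered z rz
  ... | w , qwz = ≤-trans (≤-reflexive (cong ⟦_⟧ (sym qwz))) (≤-sum (λ w → ⟦ q w z ⟧) w)

#-addPoint : ∀ {n} {p q : Fin n → Bool} {j} → p j ≡ true → q j ≡ false →
  (∀ i → i ≢ j → p i ≡ q i) → # p ≡ suc (# q)
#-addPoint {p = p} {q} {j} pj qj p≗q = trans (#-∖ p pj) (cong suc (#-cong agree))
  where
  agree : ∀ i → (p ∖ j) i ≡ q i
  agree i with i ≟ j
  ... | yes refl = trans (∧-zeroʳ (p i)) (sym qj)
  ... | no i≢j = trans (∧-identityʳ (p i)) (p≗q i i≢j)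

count-cong : ∀ {n} {p q : Fin n → Bool} → (∀ i → p i ≡ q i) → count p ≡ count q
count-cong {p = p} {q} p≗q = trans (count≡# p) (trans (#-cong p≗q) (sym (count≡# q)))

<ᵇ-true : ∀ {m n} → m < n → (m <ᵇ n) ≡ true
<ᵇ-true m<n = to T-≡ (<⇒<ᵇ m<n)

<ᵇ-false : ∀ {m n} → ¬ m < n → (m <ᵇ n) ≡ false
<ᵇ-false {m} {n} m≮n with m <ᵇ n in m<ᵇn
... | true = ⊥-elim (m≮n (<ᵇ⇒< m n (from T-≡ m<ᵇn)))
... | false = refl

<ᵇ-suc : ∀ m → (m <ᵇ suc m) ≡ true
<ᵇ-suc m = <ᵇ-true {m} ≤-refl

suc-<ᵇ : ∀ m → (suc m <ᵇ m) ≡ false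
suc-<ᵇ m = <ᵇ-false {suc m} (1+n≰n ∘ <⇒≤)

-- A record rather than reach G k x y ≡ true, so that k, x and y can be inferred from a proof.
record Reaches {n : ℕ} (G : Graph n) (k : ℕ) (x y : Fin n) : Set where
  constructor reaches
  field reached : T (reach G k x y)
open Reaches public

module _ {n : ℕ} (G : Graph n) where

  reaches-zero⁻ : ∀ {x y} → Reaches G 0 x y → x ≡ y
  reaches-zero⁻ (reaches r) = ==⇒≡ (to T-≡ r)

  reaches-refl : ∀ k x → Reaches G k x x
  reaches-refl zero x = reaches (from T-≡ (==-refl x))
  reaches-refl (suc k) x = reaches (from T-∨ (inj₁ (reached (reaches-refl k x))))

  reaches-suc : ∀ {k x y} → Reaches G k x y → Reaches G (suc k) x y
  reaches-suc (reaches r) = reaches (from T-∨ (inj₁ r))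

  reaches-snoc : ∀ {k x z y} → Reaches G k x z → adj G z y ≡ true → Reaches G (suc k) x y
  reaches-snoc {z = z} (reaches r) zy =
    reaches (from T-∨ (inj₂ (any⁺ _ (lose (∈-allFin z) (from T-∧ (r , from T-≡ zy))))))

  reaches-suc⁻ : ∀ {k x y} → Reaches G (suc k) x y →
    Reaches G k x y ⊎ ∃ λ z → Reaches G k x z × adj G z y ≡ true
  reaches-suc⁻ {k} {x} {y} (reaches r) with to T-∨ r
  ... | inj₁ r′ = inj₁ (reaches r′)
  ... | inj₂ r′ with satisfied (any⁻ _ (vertices n) r′)
  ... | z , rz with to T-∧ rz
  ... | xz , zy = inj₂ (z , reaches xz , to T-≡ zy)

  reaches-mono : ∀ {k k′ x y} → k ≤ k′ → Reaches G k x y → Reaches G k′ x y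
  reaches-mono {k′ = k′} z≤n r with reaches-zero⁻ r
  ... | refl = reaches-refl k′ _
  reaches-mono {suc k} {suc k′} (s≤s k≤k′) r with reaches-suc⁻ r
  ... | inj₁ r′ = reaches-suc (reaches-mono k≤k′ r′)
  ... | inj₂ (z , xz , zy) = reaches-snoc (reaches-mono k≤k′ xz) zy

  searchDist-spec : ∀ {x y} s f → (∀ j → j < s → ¬ Reaches G j x y) → Reaches G (s + f) x y →
    Reaches G (searchDist G x y s f) x y × (∀ j → j < searchDist G x y s f → ¬ Reaches G j x y)
  searchDist-spec s zero below r rewrite +-identityʳ s = r , below
  searchDist-spec {x} {y} s (suc f) below r with reach G s x y in found
  ... | true = reaches (from T-≡ found) , below
  ... | false = searchDist-spec (suc s) f below′ (subst (λ t → Reaches G t x y) (+-suc s f) r)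
    where
    below′ : ∀ j → j < suc s → ¬ Reaches G j x y
    below′ j j<1+s rj with m≤n⇒m<n∨m≡n (≤-pred j<1+s)
    ... | inj₁ j<s = below j j<s rj
    ... | inj₂ refl = subst T found (reached rj)

  module _ (connected : Connected G) where

    dist-spec : ∀ x y → Reaches G (dist G x y) x y × (∀ j → j < dist G x y → ¬ Reaches G j x y)
    dist-spec x y = searchDist-spec 0 n (λ j ()) (reaches (from T-≡ (connected x y)))

    dist-reaches : ∀ x y → Reaches G (dist G x y) x y
    dist-reaches x y = proj₁ (dist-spec x y)

    dist-≤ : ∀ {k x y} → Reaches G k x y → dist G x y ≤ k
    dist-≤ {k} {x} {y} r with dist G x y ≤? k
    ... | yes d≤k = d≤k
    ... | no d≰k = ⊥-elim (proj₂ (dist-spec x y) k (≰⇒> d≰k) r)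

    dist-self : ∀ x → dist G x x ≡ 0
    dist-self x = n≤0⇒n≡0 (dist-≤ (reaches-refl 0 x))

    dist≡0⇒≡ : ∀ {x y} → dist G x y ≡ 0 → x ≡ y
    dist≡0⇒≡ {x} {y} d≡0 = reaches-zero⁻ (subst (λ t → Reaches G t x y) d≡0 (dist-reaches x y))

    dist-pos : ∀ {x y} → x ≢ y → 0 < dist G x y
    dist-pos {x} {y} x≢y = n≢0⇒n>0 (x≢y ∘ dist≡0⇒≡)

    dist-lastEdge : ∀ {x y m} → dist G x y ≡ suc m → ∃ λ z → dist G x z ≤ m × adj G z y ≡ true
    dist-lastEdge {x} {y} {m} d≡1+m with reaches-suc⁻ (subst (λ t → Reaches G t x y) d≡1+m (dist-reaches x y))
    ... | inj₁ r = ⊥-elim (proj₂ (dist-spec x y) m (≤-reflexive (sym d≡1+m)) r)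
    ... | inj₂ (z , xz , zy) = z , dist-≤ xz , zy

    dist-suc : ∀ {x y x′ y′} → ¬ Reaches G 0 x y → (∀ k → Reaches G (suc k) x y → Reaches G k x′ y′) →
      (∀ k → Reaches G k x′ y′ → Reaches G (suc k) x y) → dist G x y ≡ suc (dist G x′ y′)
    dist-suc {x} {y} {x′} {y′} not0 shorter longer with dist G x y in d≡
    ... | zero = ⊥-elim (not0 (subst (λ t → Reaches G t x y) d≡ (dist-reaches x y)))
    ... | suc m = cong suc (≤-antisym
          (≤-pred (subst (_≤ suc (dist G x′ y′)) d≡ (dist-≤ (longer _ (dist-reaches x′ y′)))))
          (dist-≤ (shorter m (subst (λ t → Reaches G t x y) d≡ (dist-reaches x y)))))

module _ {n : ℕ} {G H : Graph n} (connG : Connected G) (connH : Connected H) where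

  dist-cong : ∀ {x y x′ y′} → (∀ k → Reaches G k x y → Reaches H k x′ y′) →
    (∀ k → Reaches H k x′ y′ → Reaches G k x y) → dist G x y ≡ dist H x′ y′
  dist-cong G⇒H H⇒G = ≤-antisym (dist-≤ G connG (H⇒G _ (dist-reaches H connH _ _)))
                                (dist-≤ H connH (G⇒H _ (dist-reaches G connG _ _)))

module _ {n : ℕ} (G : Graph n) (x : Fin n) where

  private
    Stable : ℕ → Set
    Stable k = ∀ {y} → Reaches G (suc k) x y → Reaches G k x y

    stable⇒closed : ∀ {k} → Stable k → ∀ {j y} → Reaches G j x y → Reaches G k x y
    stable⇒closed st {zero} r = reaches-mono G z≤n r
    stable⇒closed st {suc j} r with reaches-suc⁻ G r
    ... | inj₁ r′ = stable⇒closed st r′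
    ... | inj₂ (z , xz , zy) = st (reaches-snoc G (stable⇒closed st xz) zy)

    ball-grows : ∀ k i → reach G k x i ≡ true → reach G (suc k) x i ≡ true
    ball-grows k i r = to T-≡ (reached (reaches-suc G {k} {x} {i} (reaches (from T-≡ r))))

    -- The ball of radius k has more than k vertices unless it is already closed,
    -- so radius n - 1 reaches everything that is reachable at all.
    grows-or-stable : ∀ k → k < # (reach G k x) ⊎ Stable k
    grows-or-stable zero = inj₁ (#-pos (reach G 0 x) (==-refl x))
    grows-or-stable (suc k) with grows-or-stable k
    ... | inj₂ st = inj₂ (reaches-suc G ∘ stable⇒closed st)
    ... | inj₁ k<# with any? (λ y → (reach G (suc k) x y ∧ not (reach G k x y)) Bool.≟ true)
    ...   | yes (y , new) with to T-∧ (from T-≡ new)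
    ...     | reached-now , not-before =
      inj₁ (≤-trans (s≤s k<#) (#-strict (ball-grows k) (not-T not-before) (to T-≡ reached-now)))
      where
      not-T : ∀ {b} → T (not b) → b ≡ false
      not-T {false} _ = refl
    grows-or-stable (suc k) | inj₁ k<# | no none = inj₂ (reaches-suc G ∘ stable⇒closed stable)
      where
      stable : Stable k
      stable {y} (reaches r) with reach G k x y in before
      ... | true = reaches (from T-≡ before)
      ... | false = ⊥-elim (none (y , new))
        where
        new : (reach G (suc k) x y ∧ not (reach G k x y)) ≡ true
        new rewrite before = trans (∧-identityʳ _) (to T-≡ r)

  reaches-within : ∀ {m} → n ≡ suc m → ∀ {j y} → Reaches G j x y → Reaches G m x y
  reaches-within {m} n≡1+m {y = y} r with grows-or-stable m
  ... | inj₂ st = stable⇒closed st r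
  ... | inj₁ m<# = reaches (from T-≡ (#-full (reach G m x) (subst (_≤ # (reach G m x)) (sym n≡1+m) m<#) y))

adj⇒≢ : ∀ {n} (G : Graph n) {u w} → adj G u w ≡ true → u ≢ w
adj⇒≢ G {u} uw refl with trans (sym uw) (Graph.irrefl G u)
... | ()

module Pendant {n : ℕ} (G : Graph n) {ℓ p : Fin n}
  (only-p : ∀ y → adj G ℓ y ≡ true → y ≡ p) (pℓ : adj G p ℓ ≡ true) where

  private
    ℓp : adj G ℓ p ≡ true
    ℓp = trans (Graph.sym G ℓ p) pℓ

    p≢ℓ : p ≢ ℓ
    p≢ℓ = adj⇒≢ G pℓ

  adj-pendant : ∀ {u} → u ≢ p → adj G u ℓ ≡ false
  adj-pendant {u} u≢p with adj G u ℓ in uℓ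
  ... | true = ⊥-elim (u≢p (only-p u (trans (Graph.sym G ℓ u) uℓ)))
  ... | false = refl

  reaches-zero-to : ∀ {x} → x ≢ ℓ → ¬ Reaches G 0 x ℓ
  reaches-zero-to x≢ℓ = x≢ℓ ∘ reaches-zero⁻ G

  reaches-zero-from : ∀ {y} → y ≢ ℓ → ¬ Reaches G 0 ℓ y
  reaches-zero-from y≢ℓ = y≢ℓ ∘ sym ∘ reaches-zero⁻ G

  reaches-to⁻ : ∀ k {x} → x ≢ ℓ → Reaches G (suc k) x ℓ → Reaches G k x p
  reaches-to⁻ k x≢ℓ r with reaches-suc⁻ G r
  reaches-to⁻ zero x≢ℓ r | inj₁ r′ = ⊥-elim (reaches-zero-to x≢ℓ r′)
  reaches-to⁻ (suc k) x≢ℓ r | inj₁ r′ = reaches-suc G (reaches-to⁻ k x≢ℓ r′)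
  ... | inj₂ (z , xz , zℓ) with only-p z (trans (Graph.sym G ℓ z) zℓ)
  ... | refl = xz

  reaches-to⁺ : ∀ {k x} → Reaches G k x p → Reaches G (suc k) x ℓ
  reaches-to⁺ r = reaches-snoc G r pℓ

  reaches-from⁻ : ∀ k {y} → y ≢ ℓ → Reaches G (suc k) ℓ y → Reaches G k p y
  reaches-from⁻ k y≢ℓ r with reaches-suc⁻ G r
  reaches-from⁻ zero y≢ℓ r | inj₁ r′ = ⊥-elim (reaches-zero-from y≢ℓ r′)
  reaches-from⁻ (suc k) y≢ℓ r | inj₁ r′ = reaches-suc G (reaches-from⁻ k y≢ℓ r′)
  reaches-from⁻ k {y} y≢ℓ r | inj₂ (z , ℓz , zy) with z ≟ ℓ
  ... | yes refl with only-p y zy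
  ...   | refl = reaches-refl G k p
  reaches-from⁻ zero y≢ℓ r | inj₂ (z , ℓz , zy) | no z≢ℓ = ⊥-elim (reaches-zero-from z≢ℓ ℓz)
  reaches-from⁻ (suc k) y≢ℓ r | inj₂ (z , ℓz , zy) | no z≢ℓ =
    reaches-snoc G (reaches-from⁻ k z≢ℓ ℓz) zy

  reaches-from⁺ : ∀ {k y} → Reaches G k p y → Reaches G (suc k) ℓ y
  reaches-from⁺ {zero} r with reaches-zero⁻ G r
  ... | refl = reaches-snoc G (reaches-refl G 0 ℓ) ℓp
  reaches-from⁺ {suc k} r with reaches-suc⁻ G r
  ... | inj₁ r′ = reaches-suc G (reaches-from⁺ r′)
  ... | inj₂ (z , pz , zy) = reaches-snoc G (reaches-from⁺ pz) zy

  module _ (connected : Connected G) where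

    dist-toPendant : ∀ {x} → x ≢ ℓ → dist G x ℓ ≡ suc (dist G x p)
    dist-toPendant x≢ℓ =
      dist-suc G connected (reaches-zero-to x≢ℓ) (λ k → reaches-to⁻ k x≢ℓ) (λ k → reaches-to⁺)

    dist-fromPendant : ∀ {y} → y ≢ ℓ → dist G ℓ y ≡ suc (dist G p y)
    dist-fromPendant y≢ℓ =
      dist-suc G connected (reaches-zero-from y≢ℓ) (λ k → reaches-from⁻ k y≢ℓ) (λ k → reaches-from⁺)

    private
      dist-ℓp : dist G ℓ p ≡ 1
      dist-ℓp = trans (dist-fromPendant p≢ℓ) (cong suc (dist-self G connected p))

    nClose-pendant : nClose G ℓ p ≡ 1
    nClose-pendant = trans (count-cong closer) (trans (count≡# (_== ℓ)) (#-singleton ℓ))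
      where
      closer : ∀ x → (dist G x ℓ <ᵇ dist G x p) ≡ (x == ℓ)
      closer x with toSum (x ≟ ℓ)
      ... | inj₁ refl = trans (cong₂ _<ᵇ_ (dist-self G connected ℓ) dist-ℓp) (sym (==-refl ℓ))
      ... | inj₂ x≢ℓ rewrite dist-toPendant x≢ℓ | ==-≢ x≢ℓ = suc-<ᵇ (dist G x p)

    nClose-neighbour : suc (nClose G p ℓ) ≡ n
    nClose-neighbour = begin
      suc (nClose G p ℓ)              ≡⟨ cong suc (trans (count-cong closer) (count≡# (not ∘ (_== ℓ)))) ⟩
      suc (# (not ∘ (_== ℓ)))         ≡⟨ cong (_+ # (not ∘ (_== ℓ))) (#-singleton ℓ) ⟨
      # (_== ℓ) + # (not ∘ (_== ℓ))   ≡⟨ #-complement (_== ℓ) ⟩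
      n                               ∎
      where
      open ≡-Reasoning
      closer : ∀ x → (dist G x p <ᵇ dist G x ℓ) ≡ not (x == ℓ)
      closer x with toSum (x ≟ ℓ)
      ... | inj₁ refl = trans (cong₂ _<ᵇ_ dist-ℓp (dist-self G connected ℓ)) (sym (cong not (==-refl ℓ)))
      ... | inj₂ x≢ℓ rewrite dist-toPendant x≢ℓ | ==-≢ x≢ℓ = <ᵇ-suc (dist G x p)

reattach : ∀ {n} (G : Graph n) (b a : Fin n) → a ≢ b → Graph n
reattach G b a a≢b = record { adj = adj′ ; sym = sym′ ; irrefl = irrefl′ }
  where
  adj′ : _ → _ → Bool
  adj′ x y = if x == b then y == a else (if y == b then x == a else adj G x y)

  sym′ : ∀ x y → adj′ x y ≡ adj′ y x
  sym′ x y with x ≟ b | y ≟ b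
  ... | yes refl | yes refl = refl
  ... | yes refl | no _ = refl
  ... | no _ | yes refl = refl
  ... | no _ | no _ = Graph.sym G x y

  irrefl′ : ∀ x → adj′ x x ≡ false
  irrefl′ x with x ≟ b
  ... | yes refl = ==-≢ (a≢b ∘ sym)
  ... | no _ = Graph.irrefl G x

inhabited⇒≡suc : ∀ {n} → Fin n → ∃ λ m → n ≡ suc m
inhabited⇒≡suc {suc m} _ = m , refl

module Reattach {n : ℕ} (T : Graph n) (connected : Connected T) {v b : Fin n}
  (only-v : ∀ y → adj T b y ≡ true → y ≡ v) (vb : adj T v b ≡ true)
  {a : Fin n} (a≢b : a ≢ b) where

  H : Graph n
  H = reattach T b a a≢b

  v≢b : v ≢ b
  v≢b = adj⇒≢ T vb

  adj-off : ∀ {x y} → x ≢ b → y ≢ b → adj H x y ≡ adj T x y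
  adj-off x≢b y≢b rewrite ==-≢ x≢b | ==-≢ y≢b = refl

  adj-from-b : ∀ y → adj H b y ≡ (y == a)
  adj-from-b y rewrite ==-refl b = refl

  adj-to-b : ∀ {x} → x ≢ b → adj H x b ≡ (x == a)
  adj-to-b x≢b rewrite ==-≢ x≢b | ==-refl b = refl

  only-a : ∀ y → adj H b y ≡ true → y ≡ a
  only-a y by = ==⇒≡ (trans (sym (adj-from-b y)) by)

  ab : adj H a b ≡ true
  ab = trans (adj-to-b a≢b) (==-refl a)

  module PendantInT = Pendant T only-v vb
  module PendantInH = Pendant H only-a ab

  private
    via-a : ∀ {k x} → x ≢ b → Reaches H k x b → Reaches H k x a
    via-a {zero} x≢b r = ⊥-elim (PendantInH.reaches-zero-to x≢b r)
    via-a {suc k} x≢b r = reaches-suc H (PendantInH.reaches-to⁻ k x≢b r)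

    via-v : ∀ {k x} → x ≢ b → Reaches T k x b → Reaches T k x v
    via-v {zero} x≢b r = ⊥-elim (PendantInT.reaches-zero-to x≢b r)
    via-v {suc k} x≢b r = reaches-suc T (PendantInT.reaches-to⁻ k x≢b r)

  reaches-H⇒T : ∀ k {x y} → x ≢ b → y ≢ b → Reaches H k x y → Reaches T k x y
  reaches-H⇒T zero x≢b y≢b (reaches r) = reaches r
  reaches-H⇒T (suc k) {x} {y} x≢b y≢b r with reaches-suc⁻ H r
  ... | inj₁ r′ = reaches-suc T (reaches-H⇒T k x≢b y≢b r′)
  ... | inj₂ (z , xz , zy) with toSum (z ≟ b)
  ...   | inj₁ refl with only-a y zy
  ...     | refl = reaches-suc T (reaches-H⇒T k x≢b a≢b (via-a x≢b xz))
  reaches-H⇒T (suc k) {x} {y} x≢b y≢b r | inj₂ (z , xz , zy) | inj₂ z≢b =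
    reaches-snoc T (reaches-H⇒T k x≢b z≢b xz) (trans (sym (adj-off z≢b y≢b)) zy)

  reaches-T⇒H : ∀ k {x y} → x ≢ b → y ≢ b → Reaches T k x y → Reaches H k x y
  reaches-T⇒H zero x≢b y≢b (reaches r) = reaches r
  reaches-T⇒H (suc k) {x} {y} x≢b y≢b r with reaches-suc⁻ T r
  ... | inj₁ r′ = reaches-suc H (reaches-T⇒H k x≢b y≢b r′)
  ... | inj₂ (z , xz , zy) with toSum (z ≟ b)
  ...   | inj₁ refl with only-v y zy
  ...     | refl = reaches-suc H (reaches-T⇒H k x≢b v≢b (via-v x≢b xz))
  reaches-T⇒H (suc k) {x} {y} x≢b y≢b r | inj₂ (z , xz , zy) | inj₂ z≢b =
    reaches-snoc H (reaches-T⇒H k x≢b z≢b xz) (trans (adj-off z≢b y≢b) zy)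

  private
    reaches-T : ∀ x y → Reaches T n x y
    reaches-T x y = reaches (from T-≡ (connected x y))

    reachable-in-H : ∀ x y → ∃ λ k → Reaches H k x y
    reachable-in-H x y with x ≟ b | y ≟ b
    ... | yes refl | yes refl = 0 , reaches-refl H 0 b
    ... | no x≢b | no y≢b = n , reaches-T⇒H n x≢b y≢b (reaches-T x y)
    ... | no x≢b | yes refl = suc n , PendantInH.reaches-to⁺ (reaches-T⇒H n x≢b a≢b (reaches-T x a))
    ... | yes refl | no y≢b = suc n , PendantInH.reaches-from⁺ (reaches-T⇒H n a≢b y≢b (reaches-T a y))

  connected-H : Connected H
  connected-H x y with inhabited⇒≡suc x
  ... | m , n≡1+m = to T-≡ (reached (subst (λ t → Reaches H t x y) (sym n≡1+m)
                      (reaches-suc H (reaches-within H x n≡1+m (proj₂ (reachable-in-H x y))))))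

  dist-off : ∀ {x y} → x ≢ b → y ≢ b → dist H x y ≡ dist T x y
  dist-off x≢b y≢b =
    dist-cong connected-H connected (λ k → reaches-H⇒T k x≢b y≢b) (λ k → reaches-T⇒H k x≢b y≢b)

  deg-off : ∀ {u} → u ≢ v → u ≢ a → u ≢ b → deg H u ≡ deg T u
  deg-off {u} u≢v u≢a u≢b = count-cong same
    where
    same : ∀ y → adj H u y ≡ adj T u y
    same y with toSum (y ≟ b)
    ... | inj₁ refl = trans (adj-to-b u≢b) (trans (==-≢ u≢a) (sym (PendantInT.adj-pendant u≢v)))
    ... | inj₂ y≢b = adj-off u≢b y≢b

  deg-v : v ≢ a → deg T v ≡ suc (deg H v)
  deg-v v≢a = trans (count≡# (adj T v)) (trans (#-addPoint vb (trans (adj-to-b v≢b) (==-≢ v≢a)) same)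
                                              (cong suc (sym (count≡# (adj H v)))))
    where
    same : ∀ y → y ≢ b → adj T v y ≡ adj H v y
    same y y≢b = sym (adj-off v≢b y≢b)

  deg-a : a ≢ v → deg H a ≡ suc (deg T a)
  deg-a a≢v = trans (count≡# (adj H a)) (trans (#-addPoint ab (PendantInT.adj-pendant a≢v) same)
                                              (cong suc (sym (count≡# (adj T a)))))
    where
    same : ∀ y → y ≢ b → adj H a y ≡ adj T a y
    same y y≢b = adj-off a≢b y≢b

  deg-b : deg H b ≡ 1
  deg-b = trans (count≡# (adj H b)) (trans (#-cong adj-from-b) (#-singleton a))

sum-map-tabulate : ∀ {A : Set} {n} (f : A → ℕ) (g : Fin n → A) →
  sumˡ (map f (tabulate g)) ≡ sum (f ∘ g)
sum-map-tabulate {n = zero} f g = refl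
sum-map-tabulate {n = suc n} f g = cong (f (g zero) +_) (sum-map-tabulate f (g ∘ suc))

upper : ∀ {n} → (Fin n → Fin n → ℕ) → Fin n → Fin n → ℕ
upper F u w = if toℕ u <ᵇ toℕ w then F u w else 0

upper-+-transpose : ∀ {n} (F : Fin n → Fin n → ℕ) → (∀ u w → F u w ≡ F w u) → (∀ u → F u u ≡ 0) →
  ∀ u w → upper F u w + upper F w u ≡ F u w
upper-+-transpose F F-sym F-diag u w with <-cmp (toℕ u) (toℕ w)
... | tri< u<w _ w≮u rewrite <ᵇ-true u<w | <ᵇ-false w≮u = +-identityʳ (F u w)
... | tri> u≮w _ w<u rewrite <ᵇ-true w<u | <ᵇ-false u≮w = F-sym w u
... | tri≈ u≮w u≡w _ with toℕ-injective u≡w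
...   | refl rewrite <ᵇ-false u≮w = sym (F-diag u)

sum-upper-double : ∀ {n} (F : Fin n → Fin n → ℕ) → (∀ u w → F u w ≡ F w u) → (∀ u → F u u ≡ 0) →
  2 * sum (λ u → sum (upper F u)) ≡ sum (λ u → sum (F u))
sum-upper-double F F-sym F-diag = begin
  2 * ∑U
    ≡⟨ cong (∑U +_) (+-identityʳ ∑U) ⟩
  ∑U + ∑U
    ≡⟨ cong (∑U +_) (∑-comm (upper F)) ⟩
  ∑U + sum (λ u → sum (λ w → upper F w u))
    ≡⟨ ∑-distrib-+ (λ u → sum (upper F u)) (λ u → sum (λ w → upper F w u)) ⟨
  sum (λ u → sum (upper F u) + sum (λ w → upper F w u))
    ≡⟨ sum-cong-≗ (λ u → sym (∑-distrib-+ (upper F u) (λ w → upper F w u))) ⟩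
  sum (λ u → sum (λ w → upper F u w + upper F w u))
    ≡⟨ sum-cong-≗ (λ u → sum-cong-≗ (upper-+-transpose F F-sym F-diag u)) ⟩
  sum (λ u → sum (F u)) ∎
  where
  open ≡-Reasoning
  ∑U : ℕ
  ∑U = sum (λ u → sum (upper F u))

handshake : ∀ {n} (G : Graph n) → 2 * edgeCount G ≡ sum (deg G)
handshake {n} G = begin
  2 * edgeCount G                          ≡⟨ cong (2 *_) edgeCount≡ ⟩
  2 * ∑U                                   ≡⟨ sum-upper-double A (λ u w → cong ⟦_⟧ (Graph.sym G u w))
                                                                 (λ u → cong ⟦_⟧ (Graph.irrefl G u)) ⟩
  sum (λ u → sum (A u))                    ≡⟨ sum-cong-≗ (λ u → sym (count≡# (adj G u))) ⟩
  sum (deg G)                              ∎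
  where
  open ≡-Reasoning
  A : Fin n → Fin n → ℕ
  A u w = ⟦ adj G u w ⟧
  ∑U : ℕ
  ∑U = sum (λ u → sum (upper A u))
  upper-≡ : ∀ u w → ⟦ (toℕ u <ᵇ toℕ w) ∧ adj G u w ⟧ ≡ upper A u w
  upper-≡ u w with toℕ u <ᵇ toℕ w
  ... | true = refl
  ... | false = refl
  edgeCount≡ : edgeCount G ≡ ∑U
  edgeCount≡ = trans (sum-map-tabulate {n = n} _ (λ u → u))
                     (sum-cong-≗ (λ u → trans (count≡# (λ w → (toℕ u <ᵇ toℕ w) ∧ adj G u w))
                                              (sum-cong-≗ (upper-≡ u))))

contribution : ∀ {n} → Graph n → Fin n → Fin n → ℕ
contribution G u w = if adj G u w then (deg G u + deg G w) * nClose G u w * nClose G w u else 0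

contribution-sym : ∀ {n} (G : Graph n) u w → contribution G u w ≡ contribution G w u
contribution-sym G u w rewrite Graph.sym G u w with adj G w u
... | false = refl
... | true = swap (deg G u) (deg G w) (nClose G u w) (nClose G w u)
  where
  swap : ∀ x y p q → (x + y) * p * q ≡ (y + x) * q * p
  swap = solve-∀

contribution-diag : ∀ {n} (G : Graph n) u → contribution G u u ≡ 0
contribution-diag G u rewrite Graph.irrefl G u = refl

contribution-edge : ∀ {n} (G : Graph n) {u w} → adj G u w ≡ true →
  contribution G u w ≡ (deg G u + deg G w) * nClose G u w * nClose G w u
contribution-edge G uw rewrite uw = refl

contribution-nonedge : ∀ {n} (G : Graph n) {u w} → adj G u w ≡ false → contribution G u w ≡ 0
contribution-nonedge G uw rewrite uw = refl

wSz-double : ∀ {n} (G : Graph n) → 2 * wSz G ≡ sum (λ u → sum (contribution G u))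
wSz-double {n} G = begin
  2 * wSz G         ≡⟨ cong (2 *_) wSz≡ ⟩
  2 * ∑U            ≡⟨ sum-upper-double (contribution G) (contribution-sym G) (contribution-diag G) ⟩
  sum (λ u → sum (contribution G u)) ∎
  where
  open ≡-Reasoning
  ∑U : ℕ
  ∑U = sum (λ u → sum (upper (contribution G) u))
  upper-≡ : ∀ u w → (if (toℕ u <ᵇ toℕ w) ∧ adj G u w
                      then (deg G u + deg G w) * nClose G u w * nClose G w u else 0)
                    ≡ upper (contribution G) u w
  upper-≡ u w with toℕ u <ᵇ toℕ w
  ... | true = refl
  ... | false = refl
  wSz≡ : wSz G ≡ ∑U
  wSz≡ = trans (sum-map-tabulate {n = n} _ (λ u → u))
               (sum-cong-≗ (λ u → trans (sum-map-tabulate {n = n} _ (λ w → w)) (sum-cong-≗ (upper-≡ u))))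

leaf-neighbour : ∀ {n} (G : Graph n) {ℓ p} → IsLeaf G ℓ → adj G p ℓ ≡ true →
  ∀ y → adj G ℓ y ≡ true → y ≡ p
leaf-neighbour G {ℓ} {p} leaf pℓ y ℓy with toSum (y ≟ p)
... | inj₁ y≡p = y≡p
... | inj₂ y≢p = ⊥-elim (1+n≰n (subst (2 ≤_) (trans (sym (count≡# (adj G ℓ))) leaf)
                         (#-two (adj G ℓ) y≢p ℓy (trans (Graph.sym G ℓ p) pℓ))))

δ : ∀ {n} → Fin n → ℕ → Fin n → ℕ
δ p c u = if u == p then c else 0

δ-self : ∀ {n} (p : Fin n) c → δ p c p ≡ c
δ-self p c rewrite ==-refl p = refl

δ-other : ∀ {n} {p u : Fin n} c → u ≢ p → δ p c u ≡ 0
δ-other c u≢p rewrite ==-≢ u≢p = refl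

sum-δ : ∀ {n} (p : Fin n) c → sum (δ p c) ≡ c
sum-δ p c = trans (sum-point (δ p c) p (λ u → δ-other c)) (δ-self p c)

sum-+-mono-≤ : ∀ {n} {f φ g γ : Fin n → ℕ} → (∀ i → f i + φ i ≤ g i + γ i) →
  sum f + sum φ ≤ sum g + sum γ
sum-+-mono-≤ {f = f} {φ} {g} {γ} pointwise =
  subst₂ _≤_ (∑-distrib-+ f φ) (∑-distrib-+ g γ) (sum-mono-≤ pointwise)

sum-+δ : ∀ {n} (f : Fin n → ℕ) p c → sum (λ u → f u + δ p c u) ≡ sum f + c
sum-+δ f p c = trans (∑-distrib-+ f (δ p c)) (cong (sum f +_) (sum-δ p c))

-- With d = 3 + e the right side exceeds the left by exactly 4 e + 4 at the smallest admissible G.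
exchange-surplus : ∀ d k G → 3 ≤ d → 3 * (1 + k) ≤ G →
  let c₁ = (d + 1) * (3 + k) ; c₂ = (d + 1) * (2 + k) * 2 ; c₃ = 3 * (3 + k)
  in c₂ + (c₂ + c₃) + c₃ < G + (G + c₁ + c₁) + c₁ + c₁
exchange-surplus (suc (suc zero)) k G (s≤s (s≤s ())) _
exchange-surplus (suc (suc (suc e))) k G _ G≥ =
  ≤-trans (≤-trans (s≤s (m≤m+n _ (e * 4 + 3))) (≤-reflexive (identity e k)))
          (+-monoˡ-≤ _ (+-monoˡ-≤ _ (+-mono-≤ G≥ (+-monoˡ-≤ _ (+-monoˡ-≤ _ G≥)))))
  where
  identity : ∀ e k →
    let d = 3 + e ; c₁ = (d + 1) * (3 + k) ; c₂ = (d + 1) * (2 + k) * 2 ; c₃ = 3 * (3 + k) ; G₀ = 3 * (1 + k)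
    in suc (c₂ + (c₂ + c₃) + c₃) + (e * 4 + 3) ≡ G₀ + (G₀ + c₁ + c₁) + c₁ + c₁
  identity = solve-∀

module Configuration {n k : ℕ} (n≡4+k : n ≡ 4 + k) (T : Graph n) (connected : Connected T) {v a b : Fin n}
  (va : adj T v a ≡ true) (vb : adj T v b ≡ true) (a≢b : a ≢ b)
  (leaf-a : IsLeaf T a) (leaf-b : IsLeaf T b) where

  only-v-at-b : ∀ y → adj T b y ≡ true → y ≡ v
  only-v-at-b = leaf-neighbour T leaf-b vb

  open Reattach T connected only-v-at-b vb a≢b public

  only-v-at-a : ∀ y → adj T a y ≡ true → y ≡ v
  only-v-at-a = leaf-neighbour T leaf-a va

  module PendantA = Pendant T only-v-at-a va

  v≢a : v ≢ a
  v≢a = adj⇒≢ T va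

  a≢v : a ≢ v
  a≢v = v≢a ∘ sym

  b≢v : b ≢ v
  b≢v = v≢b ∘ sym

  b≢a : b ≢ a
  b≢a = a≢b ∘ sym

  degree-sum-H : sum (deg H) ≡ sum (deg T)
  degree-sum-H = +-cancelʳ-≡ 1 _ _ (begin
    sum (deg H) + 1                          ≡⟨ cong (sum (deg H) +_) (sum-δ v 1) ⟨
    sum (deg H) + sum (δ v 1)                ≡⟨ ∑-distrib-+ (deg H) (δ v 1) ⟨
    sum (λ u → deg H u + δ v 1 u)            ≡⟨ sum-cong-≗ moved ⟩
    sum (λ u → deg T u + δ a 1 u)            ≡⟨ ∑-distrib-+ (deg T) (δ a 1) ⟩
    sum (deg T) + sum (δ a 1)                ≡⟨ cong (sum (deg T) +_) (sum-δ a 1) ⟩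
    sum (deg T) + 1                          ∎)
    where
    open ≡-Reasoning
    moved : ∀ u → deg H u + δ v 1 u ≡ deg T u + δ a 1 u
    moved u with toSum (u ≟ v) | toSum (u ≟ a) | toSum (u ≟ b)
    ... | inj₁ refl | _ | _ = begin
      deg H v + δ v 1 v    ≡⟨ cong (deg H v +_) (δ-self v 1) ⟩
      deg H v + 1          ≡⟨ +-comm (deg H v) 1 ⟩
      suc (deg H v)        ≡⟨ deg-v v≢a ⟨
      deg T v              ≡⟨ +-identityʳ (deg T v) ⟨
      deg T v + 0          ≡⟨ cong (deg T v +_) (δ-other 1 v≢a) ⟨
      deg T v + δ a 1 v    ∎
    ... | inj₂ u≢v | inj₁ refl | _ = begin
      deg H a + δ v 1 a    ≡⟨ cong (deg H a +_) (δ-other 1 a≢v) ⟩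
      deg H a + 0          ≡⟨ +-identityʳ (deg H a) ⟩
      deg H a              ≡⟨ deg-a a≢v ⟩
      suc (deg T a)        ≡⟨ +-comm 1 (deg T a) ⟩
      deg T a + 1          ≡⟨ cong (deg T a +_) (δ-self a 1) ⟨
      deg T a + δ a 1 a    ∎
    ... | inj₂ u≢v | inj₂ u≢a | inj₁ refl =
      cong₂ _+_ (trans deg-b (sym leaf-b)) (trans (δ-other 1 b≢v) (sym (δ-other 1 b≢a)))
    ... | inj₂ u≢v | inj₂ u≢a | inj₂ u≢b =
      cong₂ _+_ (deg-off u≢v u≢a u≢b) (trans (δ-other 1 u≢v) (sym (δ-other 1 u≢a)))

  edgeCount-H : edgeCount H ≡ edgeCount T
  edgeCount-H = *-cancelˡ-≡ _ _ 2 (trans (handshake H) (trans degree-sum-H (sym (handshake T))))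

  isTree-H : IsTree T → IsTree H
  isTree-H (_ , edges) = connected-H , trans edgeCount-H edges

  dist-to-a : ∀ {x} → x ≢ a → dist T x a ≡ suc (dist T x v)
  dist-to-a = PendantA.dist-toPendant connected

  dist-from-a : ∀ {y} → y ≢ a → dist T a y ≡ suc (dist T v y)
  dist-from-a = PendantA.dist-fromPendant connected

  dist-to-b : ∀ {x} → x ≢ b → dist T x b ≡ suc (dist T x v)
  dist-to-b = PendantInT.dist-toPendant connected

  dist-from-b : ∀ {y} → y ≢ b → dist T b y ≡ suc (dist T v y)
  dist-from-b = PendantInT.dist-fromPendant connected

  dist-from-b-in-H : ∀ {y} → y ≢ a → y ≢ b → dist H b y ≡ suc (dist T b y)
  dist-from-b-in-H {y} y≢a y≢b = begin
    dist H b y              ≡⟨ PendantInH.dist-fromPendant connected-H y≢b ⟩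
    suc (dist H a y)        ≡⟨ cong suc (dist-off a≢b y≢b) ⟩
    suc (dist T a y)        ≡⟨ cong suc (trans (dist-from-a y≢a) (sym (dist-from-b y≢b))) ⟩
    suc (dist T b y)        ∎
    where open ≡-Reasoning

  nClose-off : ∀ {u w} → u ≢ a → u ≢ b → w ≢ a → w ≢ b → nClose H u w ≡ nClose T u w
  nClose-off {u} {w} u≢a u≢b w≢a w≢b = count-cong same
    where
    same : ∀ x → (dist H x u <ᵇ dist H x w) ≡ (dist T x u <ᵇ dist T x w)
    same x with toSum (x ≟ b)
    ... | inj₁ refl = cong₂ _<ᵇ_ (dist-from-b-in-H u≢a u≢b) (dist-from-b-in-H w≢a w≢b)
    ... | inj₂ x≢b = cong₂ _<ᵇ_ (dist-off x≢b u≢b) (dist-off x≢b w≢b)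

  d : ℕ
  d = deg T v

  c₁ c₂ c₃ : ℕ
  c₁ = (d + 1) * (3 + k)
  c₂ = (d + 1) * (2 + k) * 2
  c₃ = 3 * (3 + k)

  contribution-T-leaf : ∀ {ℓ} → adj T v ℓ ≡ true → IsLeaf T ℓ →
    nClose T v ℓ ≡ 3 + k → nClose T ℓ v ≡ 1 → contribution T v ℓ ≡ c₁
  contribution-T-leaf vℓ leaf far near rewrite contribution-edge T vℓ | leaf | far | near =
    *-identityʳ c₁

  nClose-v-a : nClose T v a ≡ 3 + k
  nClose-v-a = suc-injective (trans (PendantA.nClose-neighbour connected) n≡4+k)

  nClose-v-b : nClose T v b ≡ 3 + k
  nClose-v-b = suc-injective (trans (PendantInT.nClose-neighbour connected) n≡4+k)

  contribution-T-va : contribution T v a ≡ c₁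
  contribution-T-va = contribution-T-leaf va leaf-a nClose-v-a (PendantA.nClose-pendant connected)

  contribution-T-vb : contribution T v b ≡ c₁
  contribution-T-vb = contribution-T-leaf vb leaf-b nClose-v-b (PendantInT.nClose-pendant connected)

  deg-H-a : deg H a ≡ 2
  deg-H-a = trans (deg-a a≢v) (cong suc leaf-a)

  contribution-H-ab : contribution H a b ≡ c₃
  contribution-H-ab = begin
    contribution H a b                                  ≡⟨ contribution-edge H ab ⟩
    (deg H a + deg H b) * nClose H a b * nClose H b a
      ≡⟨ cong₂ _*_ (cong₂ _*_ (cong₂ _+_ deg-H-a deg-b) far) near ⟩
    3 * (3 + k) * 1                                     ≡⟨ *-identityʳ c₃ ⟩
    c₃                                                  ∎
    where
    open ≡-Reasoning
    far : nClose H a b ≡ 3 + k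
    far = suc-injective (trans (PendantInH.nClose-neighbour connected-H) n≡4+k)
    near : nClose H b a ≡ 1
    near = PendantInH.nClose-pendant connected-H

  private
    a-or-b : Fin n → Bool
    a-or-b x = (x == a) ∨ (x == b)

    a-or-b-a : a-or-b a ≡ true
    a-or-b-a rewrite ==-refl a = refl

    a-or-b-b : a-or-b b ≡ true
    a-or-b-b rewrite ==-refl b = ∨-zeroʳ (b == a)

  nClose-H-av : nClose H a v ≤ 2
  nClose-H-av = begin
    nClose H a v                       ≡⟨ count≡# (λ x → dist H x a <ᵇ dist H x v) ⟩
    # (λ x → dist H x a <ᵇ dist H x v) ≤⟨ #-mono only-a-b ⟩
    # a-or-b                           ≤⟨ #-∨ (_== a) (_== b) ⟩
    # (_== a) + # (_== b)              ≡⟨ cong₂ _+_ (#-singleton a) (#-singleton b) ⟩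
    2                                  ∎
    where
    open ≤-Reasoning
    only-a-b : ∀ x → (dist H x a <ᵇ dist H x v) ≡ true → a-or-b x ≡ true
    only-a-b x closer with toSum (x ≟ a) | toSum (x ≟ b)
    ... | inj₁ refl | _ = a-or-b-a
    ... | inj₂ _ | inj₁ refl = a-or-b-b
    ... | inj₂ x≢a | inj₂ x≢b
      rewrite dist-off x≢b a≢b | dist-off x≢b v≢b | dist-to-a x≢a
      with () ← trans (sym (suc-<ᵇ (dist T x v))) closer

  nClose-H-va : nClose H v a ≤ 2 + k
  nClose-H-va = +-cancelʳ-≤ 2 _ _ (begin
    nClose H v a + 2                    ≡⟨ cong (_+ 2) (count≡# (λ x → dist H x v <ᵇ dist H x a)) ⟩
    # (λ x → dist H x v <ᵇ dist H x a) + 2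
                                        ≤⟨ +-mono-≤ (#-mono outside-a-b) (#-two a-or-b a≢b a-or-b-a a-or-b-b) ⟩
    # (not ∘ a-or-b) + # a-or-b         ≡⟨ trans (+-comm (# (not ∘ a-or-b)) (# a-or-b)) (#-complement a-or-b) ⟩
    n                                   ≡⟨ trans n≡4+k (cong (2 +_) (+-comm 2 k)) ⟩
    2 + k + 2                           ∎)
    where
    open ≤-Reasoning
    outside-a-b : ∀ x → (dist H x v <ᵇ dist H x a) ≡ true → not (a-or-b x) ≡ true
    outside-a-b x closer with toSum (x ≟ a) | toSum (x ≟ b)
    ... | inj₁ refl | _ rewrite dist-self H connected-H x with () ← closer
    ... | inj₂ x≢a | inj₁ refl
      rewrite dist-from-b-in-H v≢a v≢b | dist-from-b v≢b | dist-self T connected v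
            | PendantInH.dist-fromPendant connected-H a≢b | dist-self H connected-H a
      with () ← closer
    ... | inj₂ x≢a | inj₂ x≢b rewrite ==-≢ x≢a | ==-≢ x≢b = refl

  contribution-H-va : contribution H v a ≤ c₂
  contribution-H-va = begin
    contribution H v a                                  ≡⟨ contribution-edge H (trans (adj-off v≢b a≢b) va) ⟩
    (deg H v + deg H a) * nClose H v a * nClose H a v   ≡⟨ cong (λ s → s * nClose H v a * nClose H a v) degrees ⟩
    (d + 1) * nClose H v a * nClose H a v               ≤⟨ *-mono-≤ (*-monoʳ-≤ (d + 1) nClose-H-va) nClose-H-av ⟩
    c₂                                                  ∎
    where
    open ≤-Reasoning
    degrees : deg H v + deg H a ≡ d + 1
    degrees = trans (cong (deg H v +_) deg-H-a) (trans (+-suc (deg H v) 1) (cong (_+ 1) (sym (deg-v v≢a))))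

  good : Fin n → Bool
  good = adj T v ∖ a ∖ b

  gain : Fin n → ℕ
  gain w = if good w then nClose T v w * nClose T w v else 0

  gain-good : ∀ {w} → good w ≡ true → gain w ≡ nClose T v w * nClose T w v
  gain-good gw rewrite gw = refl

  gain-outside : ∀ {w} → ¬ good w ≡ true → gain w ≡ 0
  gain-outside {w} not-gw rewrite ¬-not not-gw = refl

  good⁺ : ∀ {w} → adj T v w ≡ true → w ≢ a → w ≢ b → good w ≡ true
  good⁺ vw w≢a w≢b = ∖⁺ (adj T v ∖ a) (∖⁺ (adj T v) vw w≢a) w≢b

  good⁻ : ∀ {w} → good w ≡ true → adj T v w ≡ true × w ≢ a × w ≢ b
  good⁻ gw with ∖⁻ (adj T v ∖ a) gw
  ... | g′ , w≢b with ∖⁻ (adj T v) g′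
  ...   | vw , w≢a = vw , w≢a , w≢b

  -- Of the factors of the term of vw only deg v changes, and by one.
  contribution-H-vw : ∀ {w} → w ≢ v → w ≢ a → w ≢ b → contribution H v w + gain w ≡ contribution T v w
  contribution-H-vw {w} w≢v w≢a w≢b with toSum (adj T v w Bool.≟ true)
  ... | inj₂ not-vw = trans (cong₂ _+_ (contribution-nonedge H (trans (adj-off v≢b w≢b) vw))
                                      (gain-outside (not-vw ∘ proj₁ ∘ good⁻)))
                            (sym (contribution-nonedge T vw))
    where
    vw : adj T v w ≡ false
    vw = ¬-not not-vw
  ... | inj₁ vw = begin
    contribution H v w + gain w
      ≡⟨ cong₂ _+_ (contribution-edge H (trans (adj-off v≢b w≢b) vw)) (gain-good (good⁺ vw w≢a w≢b)) ⟩
    (deg H v + deg H w) * nClose H v w * nClose H w v + nClose T v w * nClose T w v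
      ≡⟨ cong (λ t → t + nClose T v w * nClose T w v)
              (cong₂ _*_ (cong₂ _*_ (cong (deg H v +_) (deg-off w≢v w≢a w≢b)) (nClose-off v≢a v≢b w≢a w≢b))
                         (nClose-off w≢a w≢b v≢a v≢b)) ⟩
    (deg H v + deg T w) * nClose T v w * nClose T w v + nClose T v w * nClose T w v
      ≡⟨ one-more-degree (deg H v) (deg T w) (nClose T v w) (nClose T w v) ⟩
    (suc (deg H v) + deg T w) * nClose T v w * nClose T w v
      ≡⟨ cong (λ t → (t + deg T w) * nClose T v w * nClose T w v) (deg-v v≢a) ⟨
    (d + deg T w) * nClose T v w * nClose T w v
      ≡⟨ contribution-edge T vw ⟨
    contribution T v w ∎
    where
    open ≡-Reasoning
    one-more-degree : ∀ x y p q → (x + y) * p * q + p * q ≡ (suc x + y) * p * q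
    one-more-degree = solve-∀

  everything others : Fin n → Bool
  everything _ = true
  others = everything ∖ v ∖ a ∖ b

  #-others : # others ≡ 1 + k
  #-others = suc-injective (suc-injective (suc-injective (begin
    3 + # others                   ≡⟨ cong (2 +_) (#-∖ (everything ∖ v ∖ a)
                                         (∖⁺ (everything ∖ v) (∖⁺ everything refl b≢v) b≢a)) ⟨
    2 + # (everything ∖ v ∖ a)     ≡⟨ cong suc (#-∖ (everything ∖ v) (∖⁺ everything refl a≢v)) ⟨
    suc (# (everything ∖ v))       ≡⟨ #-∖ everything refl ⟨
    # everything                   ≡⟨ sum-one n ⟩
    n                              ≡⟨ n≡4+k ⟩
    4 + k                          ∎)))
    where open ≡-Reasoning

  closer-via : Fin n → Fin n → Bool
  closer-via w z = good w ∧ (dist T z w <ᵇ dist T z v)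

  -- The last edge of a shortest path from z to v avoids the leaves a and b.
  closer-via-some : ∀ {z} → others z ≡ true → ∃ λ w → closer-via w z ≡ true
  closer-via-some {z} oz with ∖⁻ (everything ∖ v ∖ a) oz
  ... | oz′ , z≢b with ∖⁻ (everything ∖ v) oz′
  ...   | oz″ , z≢a with ∖⁻ everything oz″
  ...     | _ , z≢v with dist T z v in d≡
  ...       | zero = ⊥-elim (z≢v (dist≡0⇒≡ T connected d≡))
  ...       | suc m with dist-lastEdge T connected d≡
  ...         | w , d≤m , wv = w , cong₂ _∧_ (good⁺ vw w≢a w≢b) (<ᵇ-true (s≤s d≤m))
    where
    vw : adj T v w ≡ true
    vw = trans (Graph.sym T v w) wv
    too-far : ∀ {ℓ} → dist T z ℓ ≡ suc (dist T z v) → w ≢ ℓ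
    too-far far refl = 1+n≰n (≤-trans (≤-reflexive (sym (trans far (cong suc d≡)))) (m≤n⇒m≤1+n d≤m))
    w≢a : w ≢ a
    w≢a = too-far (dist-to-a z≢a)
    w≢b : w ≢ b
    w≢b = too-far (dist-to-b z≢b)

  nClose-v-good : ∀ {w} → good w ≡ true → 3 ≤ nClose T v w
  nClose-v-good {w} gw with good⁻ gw
  ... | vw , w≢a , w≢b = subst (3 ≤_) (sym (count≡# closer-to-v))
                           (#-three closer-to-v v≢a v≢b a≢b v-closer a-closer b-closer)
    where
    closer-to-v : Fin n → Bool
    closer-to-v x = dist T x v <ᵇ dist T x w
    0<d : 0 < dist T v w
    0<d = dist-pos T connected (adj⇒≢ T vw)
    v-closer : closer-to-v v ≡ true
    v-closer rewrite dist-self T connected v = <ᵇ-true 0<d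
    a-closer : closer-to-v a ≡ true
    a-closer rewrite dist-from-a v≢a | dist-from-a w≢a | dist-self T connected v = <ᵇ-true 0<d
    b-closer : closer-to-v b ≡ true
    b-closer rewrite dist-from-b v≢b | dist-from-b w≢b | dist-self T connected v = <ᵇ-true 0<d

  gain-≥ : ∀ w → 3 * # (closer-via w) ≤ gain w
  gain-≥ w with toSum (good w Bool.≟ true)
  ... | inj₁ gw = begin
    3 * # (closer-via w)                     ≡⟨ cong (3 *_) (#-cong (λ z → cong (_∧ (dist T z w <ᵇ dist T z v)) gw)) ⟩
    3 * # (λ z → dist T z w <ᵇ dist T z v)   ≡⟨ cong (3 *_) (count≡# (λ z → dist T z w <ᵇ dist T z v)) ⟨
    3 * nClose T w v                         ≤⟨ *-monoˡ-≤ (nClose T w v) (nClose-v-good gw) ⟩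
    nClose T v w * nClose T w v              ≡⟨ gain-good gw ⟨
    gain w                                   ∎
    where open ≤-Reasoning
  ... | inj₂ not-gw rewrite #-none {p = closer-via w} (λ z → cong (_∧ _) (¬-not not-gw)) = z≤n

  sum-gain-≥ : 3 * (1 + k) ≤ sum gain
  sum-gain-≥ = begin
    3 * (1 + k)                          ≡⟨ cong (3 *_) #-others ⟨
    3 * # others                         ≤⟨ *-monoʳ-≤ 3 (#-union others closer-via (λ z → closer-via-some)) ⟩
    3 * sum (λ w → # (closer-via w))     ≡⟨ *-distribˡ-sum 3 (λ w → # (closer-via w)) ⟩
    sum (λ w → 3 * # (closer-via w))     ≤⟨ sum-mono-≤ gain-≥ ⟩
    sum gain                             ∎
    where open ≤-Reasoning

  contribution-off : ∀ {u w} → u ≢ v → u ≢ a → u ≢ b → w ≢ v → w ≢ a → w ≢ b →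
    contribution H u w ≡ contribution T u w
  contribution-off u≢v u≢a u≢b w≢v w≢a w≢b =
    cong₂ (λ t x → if t then x else 0) (adj-off u≢b w≢b)
      (cong₂ _*_ (cong₂ _*_ (cong₂ _+_ (deg-off u≢v u≢a u≢b) (deg-off w≢v w≢a w≢b))
                            (nClose-off u≢a u≢b w≢a w≢b))
                 (nClose-off w≢a w≢b u≢a u≢b))

  gain-v : gain v ≡ 0
  gain-v = gain-outside (λ gv → adj⇒≢ T (proj₁ (good⁻ gv)) refl)

  gain-a : gain a ≡ 0
  gain-a = gain-outside (λ ga → proj₁ (proj₂ (good⁻ ga)) refl)

  gain-b : gain b ≡ 0
  gain-b = gain-outside (λ gb → proj₂ (proj₂ (good⁻ gb)) refl)

  private
    H-to-a : ∀ {u} → u ≢ v → u ≢ b → contribution H u a ≡ 0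
    H-to-a u≢v u≢b = contribution-nonedge H (trans (adj-off u≢b a≢b) (PendantA.adj-pendant u≢v))

    T-to-a : ∀ {u} → u ≢ v → contribution T u a ≡ 0
    T-to-a u≢v = contribution-nonedge T (PendantA.adj-pendant u≢v)

    H-to-b : ∀ {u} → u ≢ a → u ≢ b → contribution H u b ≡ 0
    H-to-b u≢a u≢b = contribution-nonedge H (trans (adj-to-b u≢b) (==-≢ u≢a))

    T-to-b : ∀ {u} → u ≢ v → contribution T u b ≡ 0
    T-to-b u≢v = contribution-nonedge T (PendantInT.adj-pendant u≢v)

    H-from-b : ∀ {w} → w ≢ a → contribution H b w ≡ 0
    H-from-b w≢a = contribution-nonedge H (trans (adj-from-b _) (==-≢ w≢a))

    H-from-a : ∀ {w} → w ≢ v → w ≢ b → contribution H a w ≡ 0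
    H-from-a w≢v w≢b = trans (contribution-sym H a _) (H-to-a w≢v w≢b)

    T-from-b : ∀ {w} → w ≢ v → contribution T b w ≡ 0
    T-from-b w≢v = trans (contribution-sym T b _) (T-to-b w≢v)

  row-other : ∀ {u} → u ≢ v → u ≢ a → u ≢ b → sum (contribution H u) + gain u ≡ sum (contribution T u)
  row-other {u} u≢v u≢a u≢b = begin
    sum (contribution H u) + gain u                   ≡⟨ cong (sum (contribution H u) +_) (sum-δ v (gain u)) ⟨
    sum (contribution H u) + sum (δ v (gain u))       ≡⟨ ∑-distrib-+ (contribution H u) (δ v (gain u)) ⟨
    sum (λ w → contribution H u w + δ v (gain u) w)   ≡⟨ sum-cong-≗ pointwise ⟩
    sum (contribution T u)                            ∎
    where
    open ≡-Reasoning
    pointwise : ∀ w → contribution H u w + δ v (gain u) w ≡ contribution T u w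
    pointwise w with toSum (w ≟ v) | toSum (w ≟ a) | toSum (w ≟ b)
    ... | inj₁ refl | _ | _ rewrite δ-self v (gain u) | contribution-sym H u v | contribution-sym T u v =
      contribution-H-vw u≢v u≢a u≢b
    ... | inj₂ w≢v | inj₁ refl | _ rewrite δ-other (gain u) a≢v | H-to-a u≢v u≢b | T-to-a u≢v = refl
    ... | inj₂ w≢v | inj₂ w≢a | inj₁ refl
      rewrite δ-other (gain u) b≢v | H-to-b u≢a u≢b | T-to-b u≢v = refl
    ... | inj₂ w≢v | inj₂ w≢a | inj₂ w≢b rewrite δ-other (gain u) w≢v =
      trans (+-identityʳ _) (contribution-off u≢v u≢a u≢b w≢v w≢a w≢b)

  row-v : sum (contribution H v) + (sum gain + c₁ + c₁) ≤ sum (contribution T v) + c₂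
  row-v = subst₂ _≤_ (cong (sum (contribution H v) +_) extra) (cong (sum (contribution T v) +_) (sum-δ a c₂))
            (sum-+-mono-≤ pointwise)
    where
    extra : sum (λ w → gain w + δ a c₁ w + δ b c₁ w) ≡ sum gain + c₁ + c₁
    extra = trans (∑-distrib-+ (λ w → gain w + δ a c₁ w) (δ b c₁))
                  (cong₂ _+_ (trans (∑-distrib-+ gain (δ a c₁)) (cong (sum gain +_) (sum-δ a c₁))) (sum-δ b c₁))
    pointwise : ∀ w → contribution H v w + (gain w + δ a c₁ w + δ b c₁ w) ≤ contribution T v w + δ a c₂ w
    pointwise w with toSum (w ≟ v) | toSum (w ≟ a) | toSum (w ≟ b)
    ... | inj₁ refl | _ | _ rewrite contribution-diag H v | gain-v | δ-other c₁ v≢a | δ-other c₁ v≢b = z≤n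
    ... | inj₂ w≢v | inj₁ refl | _ rewrite gain-a | δ-self a c₁ | δ-other c₁ a≢b | δ-self a c₂
                                       | contribution-T-va | +-identityʳ c₁ =
      subst (contribution H v a + c₁ ≤_) (+-comm c₂ c₁) (+-monoˡ-≤ c₁ contribution-H-va)
    ... | inj₂ w≢v | inj₂ w≢a | inj₁ refl
      rewrite gain-b | δ-other c₁ b≢a | δ-self b c₁ | δ-other c₂ b≢a | H-to-b v≢a v≢b | contribution-T-vb =
      ≤-reflexive (sym (+-identityʳ c₁))
    ... | inj₂ w≢v | inj₂ w≢a | inj₂ w≢b
      rewrite δ-other c₁ w≢a | δ-other c₁ w≢b | δ-other c₂ w≢a
            | +-identityʳ (gain w) | +-identityʳ (gain w) | +-identityʳ (contribution T v w) =
      ≤-reflexive (contribution-H-vw w≢v w≢a w≢b)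

  row-a : sum (contribution H a) + c₁ ≤ sum (contribution T a) + (c₂ + c₃)
  row-a = subst₂ _≤_ (cong (sum (contribution H a) +_) (sum-δ v c₁))
                     (cong (sum (contribution T a) +_) (trans (sum-+δ (δ v c₂) b c₃) (cong (_+ c₃) (sum-δ v c₂))))
            (sum-+-mono-≤ pointwise)
    where
    pointwise : ∀ w → contribution H a w + δ v c₁ w ≤ contribution T a w + (δ v c₂ w + δ b c₃ w)
    pointwise w with toSum (w ≟ v) | toSum (w ≟ b)
    ... | inj₁ refl | _ rewrite δ-self v c₁ | δ-self v c₂ | δ-other c₃ v≢b | +-identityʳ c₂
                              | contribution-sym H a v | contribution-sym T a v | contribution-T-va =
      subst (contribution H v a + c₁ ≤_) (+-comm c₂ c₁) (+-monoˡ-≤ c₁ contribution-H-va)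
    ... | inj₂ w≢v | inj₁ refl rewrite δ-other c₁ b≢v | δ-other c₂ b≢v | δ-self b c₃
                                     | contribution-H-ab | T-to-b a≢v = ≤-reflexive (+-identityʳ c₃)
    ... | inj₂ w≢v | inj₂ w≢b rewrite δ-other c₁ w≢v | H-from-a w≢v w≢b = z≤n

  row-b : sum (contribution H b) + c₁ ≤ sum (contribution T b) + c₃
  row-b = subst₂ _≤_ (cong (sum (contribution H b) +_) (sum-δ v c₁))
                     (cong (sum (contribution T b) +_) (sum-δ a c₃))
            (sum-+-mono-≤ pointwise)
    where
    pointwise : ∀ w → contribution H b w + δ v c₁ w ≤ contribution T b w + δ a c₃ w
    pointwise w with toSum (w ≟ v) | toSum (w ≟ a)
    ... | inj₁ refl | _ rewrite δ-self v c₁ | δ-other c₃ v≢a | H-from-b v≢a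
                              | contribution-sym T b v | contribution-T-vb = ≤-reflexive (sym (+-identityʳ c₁))
    ... | inj₂ w≢v | inj₁ refl rewrite δ-other c₁ a≢v | δ-self a c₃ | contribution-sym H b a
                                     | contribution-H-ab | T-from-b a≢v = ≤-reflexive (+-identityʳ c₃)
    ... | inj₂ w≢v | inj₂ w≢a rewrite δ-other c₁ w≢v | H-from-b w≢a = z≤n

  τ κ : Fin n → ℕ
  τ u = gain u + δ v (sum gain + c₁ + c₁) u + δ a c₁ u + δ b c₁ u
  κ u = δ v c₂ u + δ a (c₂ + c₃) u + δ b c₃ u

  rows : ∀ u → sum (contribution H u) + τ u ≤ sum (contribution T u) + κ u
  rows u with toSum (u ≟ v) | toSum (u ≟ a) | toSum (u ≟ b)
  ... | inj₁ refl | _ | _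
    rewrite gain-v | δ-self v (sum gain + c₁ + c₁) | δ-other c₁ v≢a | δ-other c₁ v≢b
          | δ-self v c₂ | δ-other (c₂ + c₃) v≢a | δ-other c₃ v≢b
          | +-identityʳ (sum gain + c₁ + c₁) | +-identityʳ (sum gain + c₁ + c₁)
          | +-identityʳ c₂ | +-identityʳ c₂ = row-v
  ... | inj₂ u≢v | inj₁ refl | _
    rewrite gain-a | δ-other (sum gain + c₁ + c₁) a≢v | δ-self a c₁ | δ-other c₁ a≢b
          | δ-other c₂ a≢v | δ-self a (c₂ + c₃) | δ-other c₃ a≢b
          | +-identityʳ c₁ | +-identityʳ (c₂ + c₃) = row-a
  ... | inj₂ u≢v | inj₂ u≢a | inj₁ refl
    rewrite gain-b | δ-other (sum gain + c₁ + c₁) b≢v | δ-other c₁ b≢a | δ-self b c₁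
          | δ-other c₂ b≢v | δ-other (c₂ + c₃) b≢a | δ-self b c₃ = row-b
  ... | inj₂ u≢v | inj₂ u≢a | inj₂ u≢b
    rewrite δ-other (sum gain + c₁ + c₁) u≢v | δ-other c₁ u≢a | δ-other c₁ u≢b
          | δ-other c₂ u≢v | δ-other (c₂ + c₃) u≢a | δ-other c₃ u≢b
          | +-identityʳ (gain u) | +-identityʳ (gain u) | +-identityʳ (gain u)
          | +-identityʳ (sum (contribution T u)) = ≤-reflexive (row-other u≢v u≢a u≢b)

  sum-τ : sum τ ≡ sum gain + (sum gain + c₁ + c₁) + c₁ + c₁
  sum-τ = trans (sum-+δ _ b c₁) (cong (_+ c₁) (trans (sum-+δ _ a c₁) (cong (_+ c₁) (sum-+δ gain v _))))

  sum-κ : sum κ ≡ c₂ + (c₂ + c₃) + c₃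
  sum-κ = trans (sum-+δ _ b c₃)
                (cong (_+ c₃) (trans (sum-+δ (δ v c₂) a _) (cong (_+ (c₂ + c₃)) (sum-δ v c₂))))

  wSz-H<wSz-T : 3 ≤ d → wSz H < wSz T
  wSz-H<wSz-T 3≤d = *-cancelˡ-< 2 _ _ (+-cancelʳ-< (sum κ) _ _ (begin-strict
    2 * wSz H + sum κ                        <⟨ +-monoʳ-< (2 * wSz H) (subst₂ _<_ (sym sum-κ) (sym sum-τ)
                                                  (exchange-surplus d k (sum gain) 3≤d sum-gain-≥)) ⟩
    2 * wSz H + sum τ                        ≡⟨ cong (_+ sum τ) (wSz-double H) ⟩
    sum (λ u → sum (contribution H u)) + sum τ ≤⟨ sum-+-mono-≤ rows ⟩
    sum (λ u → sum (contribution T u)) + sum κ ≡⟨ cong (_+ sum κ) (wSz-double T) ⟨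
    2 * wSz T + sum κ                        ∎))
    where open ≤-Reasoning

proposition5 : (n : ℕ) → 3 < n → (T : Graph n) → IsTree T →
    ((T' : Graph n) → IsTree T' → wSz T ≤ wSz T') →
    (v a b : Fin n) → 6 ≤ deg T v → a ≢ b →
    ¬ (adj T v a ≡ true × adj T v b ≡ true × IsLeaf T a × IsLeaf T b)
proposition5 n 3<n T (connected , edges) minimal v a b 6≤deg a≢b (va , vb , leaf-a , leaf-b) =
  <⇒≱ (wSz-H<wSz-T 3≤deg) (minimal H (isTree-H (connected , edges)))
  where
  open Configuration (sym (proj₂ (m≤n⇒∃[o]m+o≡n 3<n))) T connected va vb a≢b leaf-a leaf-b
  3≤deg : 3 ≤ deg T v
  3≤deg = ≤-trans (s≤s (s≤s (s≤s z≤n))) 6≤deg
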